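{- For a positive integer $m$, write $m=\binom{k_1}{2}+\binom{k_2}{2}+\cdots+\binom{k_r}{2}$ with $k_1\ge k_2\ge\cdots\ge k_r\ge 2$, where $k_1,k_2,\dots$ are chosen successively (greedily) as large as possible subject to $m-\binom{k_1}{2}-\cdots-\binom{k_i}{2}\ge0$ for all $1\le i\le r$, and set $\nu(m)=k_1+\cdots+k_r$. Then $\nu(m)\le\sqrt{2m}+3m^{1/4}$ for all $m\ge 405$. -}

module Defs where

open import Data.Nat using (ℕ; zero; suc; _+_; _∸_; _≤?_)
open import Data.Nat.Combinatorics using (_C_)
open import Data.Integer using (+_)
open import Data.Rational using (ℚ; _/_)
open import Relation.Nullary using (yes; no)

largestFrom : ℕ → ℕ → ℕ
largestFrom m zero = zero
largestFrom m (suc k) with suc k C 2 ≤? m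
... | yes _ = suc k
... | no  _ = largestFrom m k

-- the largest k with (k C 2) ≤ m.  Since (m+2) C 2 > m, searching
-- downward from m + 1 finds it.
greedyK : ℕ → ℕ
greedyK m = largestFrom m (suc m)

-- greedy decomposition with fuel; each step removes at least 1 from m
-- (for m ≥ 1, greedyK m ≥ 2), so fuel m suffices.
νFuel : ℕ → ℕ → ℕ
νFuel zero    m       = zero
νFuel (suc f) zero    = zero
νFuel (suc f) (suc m) = greedyK (suc m) + νFuel f (suc m ∸ (greedyK (suc m) C 2))

ν : ℕ → ℕ
ν m = νFuel m m

ℕtoℚ : ℕ → ℚ
ℕtoℚ n = (+ n) / 1

{-# OPTIONS --safe #-}
-- Writing m = C(n,2) + j with n = greedyK m, the greedy step gives ν(m) = n + ν(j) with j < n,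
-- where n ≈ √(2m) and hence j = O(√m).  An induction along the same step shows the crude bound
-- ν(j) ≤ (13 + √(35 j))/3, so ν(j) is at most about 2.35 m^{1/4} + 13/3; for n ≥ 85 this and the
-- rounding of n against √(2m) stay below 3 m^{1/4}, and the m with n < 85 are checked by evaluation.
-- Every bound v ≤ √(2m) + 3 m^{1/4} is witnessed by naturals d, A, B with (d+1) v ≤ A + B,
-- A² ≤ 2m (d+1)² and B⁴ ≤ 81 m (d+1)⁴, which transfers to rationals by monotonicity of squaring.

module Submission where

open import Defs
open import Data.Nat using (ℕ; _≤_; _*_)
open import Data.Rational using (ℚ; 0ℚ) renaming (_≤_ to _≤ℚ_; _+_ to _+ℚ_; _*_ to _*ℚ_)

open import Algebra.Bundles using (CommutativeMonoid)
open import Data.Bool using (Bool; T; _∧_; _∨_; if_then_else_)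
open import Data.Bool.ListAction using (all; any)
open import Data.Bool.Properties using (T-∧; T-∨)
import Data.Integer as ℤ
import Data.Integer.Properties as ℤ
open import Data.List using (_∷_; []; upTo)
import Data.List.Relation.Unary.All as All
open import Data.List.Relation.Unary.All.Properties using (all⁺)
open import Data.List.Relation.Unary.Any using (satisfied)
open import Data.List.Relation.Unary.Any.Properties using (any⁻)
open import Data.List.Membership.Propositional.Properties using (∈-upTo⁺)
open import Data.Nat using (zero; suc; _+_; _∸_; _<_; _≤?_; _<?_; _≤ᵇ_; _<ᵇ_; s≤s; z≤n; z<s)
open import Data.Nat.Combinatorics using (_C_; nCk+nC[k+1]≡[n+1]C[k+1]; nC1≡n)
import Data.Nat.Coprimality as Coprime
open import Data.Nat.Induction using (<-rec)
import Data.Nat.Properties as ℕ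
open import Data.Nat.Tactic.RingSolver using (solve-∀; solve)
open import Data.Product using (_×_; _,_; proj₁; proj₂; map₂; uncurry)
open import Data.Rational using (mkℚ; _/_; *≤*; Positive; positive; nonNegative) renaming (_<_ to _<ℚ_)
import Data.Rational.Properties as ℚ
open import Data.Sum using (inj₁; inj₂; [_,_]′)
open import Function using (_∘_; Equivalence)
open import Relation.Binary.PropositionalEquality
open import Relation.Nullary using (yes; no; contradiction)

open import Algebra.Properties.CommutativeSemigroup
  (CommutativeMonoid.commutativeSemigroup ℚ.*-1-commutativeMonoid) using (interchange)

ℕtoℚ≡mkℚ : ∀ n → ℕtoℚ n ≡ mkℚ (ℤ.+ n) 0 (Coprime.sym (Coprime.1-coprimeTo n))
ℕtoℚ≡mkℚ n = ℚ.normalize-coprime (Coprime.sym (Coprime.1-coprimeTo n))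

ℕtoℚ-+ : ∀ a b → ℕtoℚ (a + b) ≡ ℕtoℚ a +ℚ ℕtoℚ b
ℕtoℚ-+ a b rewrite ℕtoℚ≡mkℚ a | ℕtoℚ≡mkℚ b =
  cong (_/ 1) (sym (cong₂ ℤ._+_ (ℤ.*-identityʳ (ℤ.+ a)) (ℤ.*-identityʳ (ℤ.+ b))))

ℕtoℚ-* : ∀ a b → ℕtoℚ (a * b) ≡ ℕtoℚ a *ℚ ℕtoℚ b
ℕtoℚ-* a b rewrite ℕtoℚ≡mkℚ a | ℕtoℚ≡mkℚ b = cong (_/ 1) (ℤ.pos-* a b)

ℕtoℚ-mono-≤ : ∀ {a b} → a ≤ b → ℕtoℚ a ≤ℚ ℕtoℚ b
ℕtoℚ-mono-≤ {a} {b} a≤b rewrite ℕtoℚ≡mkℚ a | ℕtoℚ≡mkℚ b =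
  *≤* (subst₂ ℤ._≤_ (sym (ℤ.*-identityʳ (ℤ.+ a))) (sym (ℤ.*-identityʳ (ℤ.+ b))) (ℤ.+≤+ a≤b))

0≤ℕtoℚ : ∀ n → 0ℚ ≤ℚ ℕtoℚ n
0≤ℕtoℚ n = ℕtoℚ-mono-≤ {0} {n} z≤n

ℕtoℚ-suc-positive : ∀ n → Positive (ℕtoℚ (suc n))
ℕtoℚ-suc-positive n rewrite ℕtoℚ≡mkℚ (suc n) = _

0≤p*q : ∀ {p q} → 0ℚ ≤ℚ p → 0ℚ ≤ℚ q → 0ℚ ≤ℚ p *ℚ q
0≤p*q {p} {q} 0≤p 0≤q = ℚ.nonNegative⁻¹ _
  {{ℚ.nonNeg*nonNeg⇒nonNeg p {{nonNegative 0≤p}} q {{nonNegative 0≤q}}}}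

p*p≤q*q⇒p≤q : ∀ {p q} → 0ℚ ≤ℚ q → p *ℚ p ≤ℚ q *ℚ q → p ≤ℚ q
p*p≤q*q⇒p≤q {p} {q} 0≤q pp≤qq with p ℚ.≤? q
... | yes p≤q = p≤q
... | no p≰q = contradiction (ℚ.≤-<-trans pp≤qq qq<pp) (ℚ.<-irrefl refl)
  where
  q<p : q <ℚ p
  q<p = ℚ.≰⇒> p≰q
  qq<pp : q *ℚ q <ℚ p *ℚ p
  qq<pp = ℚ.≤-<-trans (ℚ.*-monoˡ-≤-nonNeg q {{nonNegative 0≤q}} (ℚ.<⇒≤ q<p))
                      (ℚ.*-monoˡ-<-pos p {{positive (ℚ.≤-<-trans 0≤q q<p)}} q<p)

≤-scaled-sqrt : ∀ {a A D p} → 0ℚ ≤ℚ p → ℕtoℚ a ≤ℚ p *ℚ p →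
  A * A ≤ a * (D * D) → ℕtoℚ A ≤ℚ ℕtoℚ D *ℚ p
≤-scaled-sqrt {a} {A} {D} {p} 0≤p a≤pp AA≤aDD = p*p≤q*q⇒p≤q (0≤p*q (0≤ℕtoℚ D) 0≤p) (begin
  ℕtoℚ A *ℚ ℕtoℚ A               ≡⟨ ℕtoℚ-* A A ⟨
  ℕtoℚ (A * A)                   ≤⟨ ℕtoℚ-mono-≤ AA≤aDD ⟩
  ℕtoℚ (a * (D * D))             ≡⟨ trans (ℕtoℚ-* a (D * D)) (cong (ℕtoℚ a *ℚ_) (ℕtoℚ-* D D)) ⟩
  ℕtoℚ a *ℚ (ℕtoℚ D *ℚ ℕtoℚ D)  ≤⟨ ℚ.*-monoʳ-≤-nonNeg _ {{nonNegative (0≤p*q (0≤ℕtoℚ D) (0≤ℕtoℚ D))}} a≤pp ⟩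
  (p *ℚ p) *ℚ (ℕtoℚ D *ℚ ℕtoℚ D) ≡⟨ ℚ.*-comm (p *ℚ p) _ ⟩
  (ℕtoℚ D *ℚ ℕtoℚ D) *ℚ (p *ℚ p) ≡⟨ interchange (ℕtoℚ D) (ℕtoℚ D) p p ⟩
  (ℕtoℚ D *ℚ p) *ℚ (ℕtoℚ D *ℚ p) ∎)
  where open ℚ.≤-Reasoning

≤-scaled-root4 : ∀ {b B D q} → 0ℚ ≤ℚ q → ℕtoℚ b ≤ℚ q *ℚ q *ℚ q *ℚ q →
  (B * B) * (B * B) ≤ b * ((D * D) * (D * D)) → ℕtoℚ B ≤ℚ ℕtoℚ D *ℚ q
≤-scaled-root4 {b} {B} {D} {q} 0≤q b≤q⁴ B⁴≤bD⁴ = p*p≤q*q⇒p≤q (0≤p*q (0≤ℕtoℚ D) 0≤q) (begin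
  ℕtoℚ B *ℚ ℕtoℚ B               ≡⟨ ℕtoℚ-* B B ⟨
  ℕtoℚ (B * B)                   ≤⟨ ≤-scaled-sqrt {b} {B * B} {D * D} (0≤p*q 0≤q 0≤q) b≤[qq][qq] B⁴≤bD⁴ ⟩
  ℕtoℚ (D * D) *ℚ (q *ℚ q)       ≡⟨ cong (_*ℚ (q *ℚ q)) (ℕtoℚ-* D D) ⟩
  (ℕtoℚ D *ℚ ℕtoℚ D) *ℚ (q *ℚ q) ≡⟨ interchange (ℕtoℚ D) (ℕtoℚ D) q q ⟩
  (ℕtoℚ D *ℚ q) *ℚ (ℕtoℚ D *ℚ q) ∎)
  where
  open ℚ.≤-Reasoning
  b≤[qq][qq] : ℕtoℚ b ≤ℚ (q *ℚ q) *ℚ (q *ℚ q)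
  b≤[qq][qq] = subst (ℕtoℚ b ≤ℚ_) (ℚ.*-assoc (q *ℚ q) q q) b≤q⁴

-- Rational witnesses A/(d+1) ≤ √(2m) and B/(d+1) ≤ 3 m^{1/4} whose sum is at least v.
record Certificate (m v : ℕ) : Set where
  constructor certificate
  field
    d A B   : ℕ
    A-bound : A * A ≤ 2 * m * (suc d * suc d)
    B-bound : (B * B) * (B * B) ≤ 81 * m * ((suc d * suc d) * (suc d * suc d))
    split   : suc d * v ≤ A + B

certificate-sound : ∀ {m v} → Certificate m v → ∀ {p q} → 0ℚ ≤ℚ p → 0ℚ ≤ℚ q →
  ℕtoℚ (2 * m) ≤ℚ p *ℚ p → ℕtoℚ (81 * m) ≤ℚ q *ℚ q *ℚ q *ℚ q → ℕtoℚ v ≤ℚ p +ℚ q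
certificate-sound {m} {v} (certificate d A B A-bound B-bound split) {p} {q} 0≤p 0≤q 2m≤pp 81m≤q⁴ =
  ℚ.*-cancelˡ-≤-pos D {{ℕtoℚ-suc-positive d}} (begin
    D *ℚ ℕtoℚ v                            ≡⟨ ℕtoℚ-* (suc d) v ⟨
    ℕtoℚ (suc d * v)                       ≤⟨ ℕtoℚ-mono-≤ split ⟩
    ℕtoℚ (A + B)                           ≡⟨ ℕtoℚ-+ A B ⟩
    ℕtoℚ A +ℚ ℕtoℚ B                       ≤⟨ ℚ.+-mono-≤ 
                                                  (≤-scaled-sqrt {2 * m} {A} {suc d} 0≤p 2m≤pp A-bound)
                                                  (≤-scaled-root4 {81 * m} {B} {suc d} 0≤q 81m≤q⁴ B-bound) ⟩
    D *ℚ p +ℚ D *ℚ q                       ≡⟨ ℚ.*-distribˡ-+ D p q ⟨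
    D *ℚ (p +ℚ q)                          ∎)
  where
  open ℚ.≤-Reasoning
  D = ℕtoℚ (suc d)

[1+n]C2≡n+nC2 : ∀ n → suc n C 2 ≡ n + n C 2
[1+n]C2≡n+nC2 n = trans (sym (nCk+nC[k+1]≡[n+1]C[k+1] n 1)) (cong (_+ n C 2) (nC1≡n n))

2*[1+n]C2≡[1+n]*n : ∀ n → 2 * (suc n C 2) ≡ suc n * n
2*[1+n]C2≡[1+n]*n zero    = refl
2*[1+n]C2≡[1+n]*n (suc n) = begin
  2 * (suc (suc n) C 2)      ≡⟨ cong (2 *_) ([1+n]C2≡n+nC2 (suc n)) ⟩
  2 * (suc n + suc n C 2)    ≡⟨ ℕ.*-distribˡ-+ 2 (suc n) (suc n C 2) ⟩
  2 * suc n + 2 * (suc n C 2) ≡⟨ cong (2 * suc n +_) (2*[1+n]C2≡[1+n]*n n) ⟩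
  2 * suc n + suc n * n      ≡⟨ solve (n ∷ []) ⟩
  suc (suc n) * suc n        ∎
  where open ≡-Reasoning

C2-mono-≤ : ∀ {m n} → m ≤ n → m C 2 ≤ n C 2
C2-mono-≤ {n = zero}  z≤n = z≤n
C2-mono-≤ {n = suc n} m≤1+n with ℕ.m≤n⇒m<n∨m≡n m≤1+n
... | inj₂ refl = ℕ.≤-refl
... | inj₁ m<1+n = ℕ.≤-trans (C2-mono-≤ (ℕ.≤-pred m<1+n))
                     (subst (n C 2 ≤_) (sym ([1+n]C2≡n+nC2 n)) (ℕ.m≤n+m (n C 2) n))

largestFrom-spec : ∀ m k → m < suc k C 2 →
  largestFrom m k C 2 ≤ m × m < suc (largestFrom m k) C 2
largestFrom-spec m zero    ()
largestFrom-spec m (suc k) m<[2+k]C2 with suc k C 2 ≤? m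
... | yes [1+k]C2≤m = [1+k]C2≤m , m<[2+k]C2
... | no  [1+k]C2≰m = largestFrom-spec m k (ℕ.≰⇒> [1+k]C2≰m)

greedyK-spec : ∀ m → greedyK m C 2 ≤ m × m < suc (greedyK m) C 2
greedyK-spec m = largestFrom-spec m (suc m)
  (subst (m <_) (sym ([1+n]C2≡n+nC2 (suc m))) (ℕ.m≤m+n (suc m) (suc m C 2)))

remainder : ℕ → ℕ
remainder m = m ∸ greedyK m C 2

greedyK-C2+remainder≡id : ∀ m → greedyK m C 2 + remainder m ≡ m
greedyK-C2+remainder≡id m = ℕ.m+[n∸m]≡n (proj₁ (greedyK-spec m))

remainder<greedyK : ∀ m → remainder m < greedyK m
remainder<greedyK m = ℕ.+-cancelˡ-< (greedyK m C 2) (remainder m) (greedyK m)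
  (subst₂ _<_ (sym (greedyK-C2+remainder≡id m))
              (trans ([1+n]C2≡n+nC2 (greedyK m)) (ℕ.+-comm (greedyK m) _))
              (proj₂ (greedyK-spec m)))

2≤greedyK : ∀ m → 2 ≤ greedyK (suc m)
2≤greedyK m = ℕ.≮⇒≥ λ greedyK<2 →
  ℕ.<⇒≱ (proj₂ (greedyK-spec (suc m))) (ℕ.≤-trans (C2-mono-≤ greedyK<2) (s≤s z≤n))

remainder[1+m]≤m : ∀ m → remainder (suc m) ≤ m
remainder[1+m]≤m m =
  ℕ.≤-pred (ℕ.∸-monoʳ-< {o = 0} (C2-mono-≤ (2≤greedyK m)) (proj₁ (greedyK-spec (suc m))))

νFuel-irrelevant : ∀ {f g} x → x ≤ f → x ≤ g → νFuel f x ≡ νFuel g x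
νFuel-irrelevant {zero}  {zero}  zero    _ _ = refl
νFuel-irrelevant {zero}  {suc g} zero    _ _ = refl
νFuel-irrelevant {suc f} {zero}  zero    _ _ = refl
νFuel-irrelevant {suc f} {suc g} zero    _ _ = refl
νFuel-irrelevant {suc f} {suc g} (suc x) (s≤s x≤f) (s≤s x≤g) =
  cong (greedyK (suc x) +_) (νFuel-irrelevant (remainder (suc x))
    (ℕ.≤-trans (remainder[1+m]≤m x) x≤f) (ℕ.≤-trans (remainder[1+m]≤m x) x≤g))

ν-step : ∀ m → ν (suc m) ≡ greedyK (suc m) + ν (remainder (suc m))
ν-step m = cong (greedyK (suc m) +_)
  (νFuel-irrelevant (remainder (suc m)) (remainder[1+m]≤m m) ℕ.≤-refl)

m*m≤n*n⇒m≤n : ∀ {m n} → m * m ≤ n * n → m ≤ n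
m*m≤n*n⇒m≤n mm≤nn = ℕ.≮⇒≥ λ n<m → ℕ.<⇒≱ (ℕ.*-mono-< n<m n<m) mm≤nn

-- From w ≤ √(s k) one gets c + a w ≤ b k for all k ≥ k₀: writing k = k₀ + t, the
-- conditions say that a √(s (k₀ + t)) ≤ e + b t, which is checked after squaring.
linear-bound-from-square : ∀ {k w} a b c e s k₀ → c + e ≡ b * k₀ →
  a * a * (s * k₀) ≤ e * e → a * a * s ≤ 2 * e * b →
  k₀ ≤ k → w * w ≤ s * k → c + a * w ≤ b * k
linear-bound-from-square {k} {w} a b c e s k₀ c+e≡bk₀ k₀-case t-coefficient k₀≤k ww≤sk = begin
  c + a * w           ≤⟨ ℕ.+-monoʳ-≤ c aw≤e+bt ⟩
  c + (e + b * t)     ≡⟨ ℕ.+-assoc c e (b * t) ⟨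
  c + e + b * t       ≡⟨ cong (_+ b * t) c+e≡bk₀ ⟩
  b * k₀ + b * t      ≡⟨ ℕ.*-distribˡ-+ b k₀ t ⟨
  b * (k₀ + t)        ≡⟨ cong (b *_) k₀+t≡k ⟩
  b * k               ∎
  where
  open ℕ.≤-Reasoning
  t = k ∸ k₀
  k₀+t≡k : k₀ + t ≡ k
  k₀+t≡k = ℕ.m+[n∸m]≡n k₀≤k
  expand : ∀ a s k₀ t → a * a * (s * (k₀ + t)) ≡ a * a * (s * k₀) + a * a * s * t
  expand = solve-∀
  square : ∀ e b t → e * e + 2 * e * b * t + b * t * (b * t) ≡ (e + b * t) * (e + b * t)
  square = solve-∀
  aw≤e+bt : a * w ≤ e + b * t
  aw≤e+bt = m*m≤n*n⇒m≤n (begin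
    a * w * (a * w)                          ≡⟨ solve (a ∷ w ∷ []) ⟩
    a * a * (w * w)                          ≤⟨ ℕ.*-monoʳ-≤ (a * a) ww≤sk ⟩
    a * a * (s * k)                          ≡⟨ cong (λ x → a * a * (s * x)) k₀+t≡k ⟨
    a * a * (s * (k₀ + t))                   ≡⟨ expand a s k₀ t ⟩
    a * a * (s * k₀) + a * a * s * t         ≤⟨ ℕ.+-mono-≤ k₀-case (ℕ.*-monoˡ-≤ t t-coefficient) ⟩
    e * e + 2 * e * b * t                    ≤⟨ ℕ.m≤m+n _ _ ⟩
    e * e + 2 * e * b * t + b * t * (b * t)  ≡⟨ square e b t ⟩
    (e + b * t) * (e + b * t)                ∎)

crude-bound-step : ∀ {n j w} → 21 ≤ n → j < n → w * w ≤ 35 * j →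
  (3 * n + w) * (3 * n + w) ≤ 35 * (n C 2 + j)
crude-bound-step {suc k} {j} {w} (s≤s 20≤k) (s≤s j≤k) ww≤35j = ℕ.*-cancelˡ-≤ 2 (begin
  2 * ((3 * suc k + w) * (3 * suc k + w))     ≡⟨ solve (k ∷ w ∷ []) ⟩
  suc k * (18 * k + (18 + 12 * w)) + 2 * (w * w) ≤⟨ ℕ.+-mono-≤ (ℕ.*-monoʳ-≤ (suc k) (ℕ.+-monoʳ-≤ (18 * k) linear-part))
                                                                (ℕ.*-monoʳ-≤ 2 ww≤35j) ⟩
  suc k * (18 * k + 17 * k) + 2 * (35 * j)    ≡⟨ solve (k ∷ j ∷ []) ⟩
  35 * (suc k * k) + 2 * (35 * j)             ≡⟨ cong (λ x → 35 * x + 2 * (35 * j)) (2*[1+n]C2≡[1+n]*n k) ⟨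
  35 * (2 * (suc k C 2)) + 2 * (35 * j)       ≡⟨ regroup (suc k C 2) j ⟩
  2 * (35 * (suc k C 2 + j))                  ∎)
  where
  open ℕ.≤-Reasoning
  linear-part : 18 + 12 * w ≤ 17 * k
  linear-part = linear-bound-from-square {w = w} 12 17 18 322 35 20 refl (ℕ.≤ᵇ⇒≤ _ _ _) (ℕ.≤ᵇ⇒≤ _ _ _)
    20≤k (ℕ.≤-trans ww≤35j (ℕ.*-monoʳ-≤ 35 j≤k))
  regroup : ∀ c j → 35 * (2 * c) + 2 * (35 * j) ≡ 2 * (35 * (c + j))
  regroup = solve-∀

T-all-upTo : ∀ (p : ℕ → Bool) {N} → T (all p (upTo N)) → ∀ {x} → x < N → T (p x)
T-all-upTo p {N} all-p x<N = All.lookup (all⁺ p (upTo N) all-p) (∈-upTo⁺ x<N)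

crudeBoundHolds : ℕ → ℕ → Bool
crudeBoundHolds x v = (3 * v ∸ 13) * (3 * v ∸ 13) ≤ᵇ 35 * x

-- ν x is passed as an argument so that it is evaluated only once.
crude-bound-table : T (all (λ x → crudeBoundHolds x (ν x)) (upTo 210))
crude-bound-table = _

-- That is, ν x ≤ (13 + √(35 x))/3.  The induction step needs greedyK x ≥ 21, i.e. x ≥ 210.
crude-ν-bound : ∀ x → (3 * ν x ∸ 13) * (3 * ν x ∸ 13) ≤ 35 * x
crude-ν-bound = <-rec _ bound
  where
  bound : ∀ x → (∀ {y} → y < x → (3 * ν y ∸ 13) * (3 * ν y ∸ 13) ≤ 35 * y) →
    (3 * ν x ∸ 13) * (3 * ν x ∸ 13) ≤ 35 * x
  bound x rec with x <? 210
  ... | yes x<210 = ℕ.≤ᵇ⇒≤ _ _ (T-all-upTo (λ y → crudeBoundHolds y (ν y)) crude-bound-table x<210)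
  bound zero    rec | no x≮210 = contradiction z<s x≮210
  bound (suc x) rec | no x≮210 = ℕ.≤-trans (ℕ.*-mono-≤ ν-split ν-split) (subst
    (λ y → (3 * n + w) * (3 * n + w) ≤ 35 * y) (greedyK-C2+remainder≡id (suc x))
    (crude-bound-step 21≤n (remainder<greedyK (suc x)) (rec (s≤s (remainder[1+m]≤m x)))))
    where
    n = greedyK (suc x)
    j = remainder (suc x)
    w = 3 * ν j ∸ 13
    21≤n : 21 ≤ n
    21≤n = ℕ.≮⇒≥ λ n<21 → x≮210
      (ℕ.<-≤-trans (proj₂ (greedyK-spec (suc x))) (C2-mono-≤ {suc n} {21} n<21))
    ν-split : 3 * ν (suc x) ∸ 13 ≤ 3 * n + w
    ν-split = ℕ.m≤n+o⇒m∸n≤o (3 * ν (suc x)) 13 (begin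
      3 * ν (suc x)    ≡⟨ cong (3 *_) (ν-step x) ⟩
      3 * (n + ν j)    ≡⟨ ℕ.*-distribˡ-+ 3 n (ν j) ⟩
      3 * n + 3 * ν j  ≤⟨ ℕ.+-monoʳ-≤ (3 * n) (ℕ.m≤n+m∸n (3 * ν j) 13) ⟩
      3 * n + (13 + w) ≡⟨ swap (3 * n) w ⟩
      13 + (3 * n + w) ∎)
      where
      open ℕ.≤-Reasoning
      swap : ∀ a b → a + (13 + b) ≡ 13 + (a + b)
      swap = solve-∀

triangular-certificate : ∀ {k} → 1 ≤ k → Certificate (suc k C 2) (suc k)
triangular-certificate {k} 1≤k = certificate 0 k 1 A-bound B-bound (ℕ.≤-reflexive (solve (k ∷ [])))
  where
  open ℕ.≤-Reasoning
  A-bound : k * k ≤ 2 * (suc k C 2) * 1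
  A-bound = begin
    k * k                ≤⟨ ℕ.m≤n+m (k * k) k ⟩
    suc k * k            ≡⟨ 2*[1+n]C2≡[1+n]*n k ⟨
    2 * (suc k C 2)      ≡⟨ ℕ.*-identityʳ _ ⟨
    2 * (suc k C 2) * 1  ∎
  B-bound : 1 ≤ 81 * (suc k C 2) * 1
  B-bound = begin
    1                    ≤⟨ C2-mono-≤ (s≤s 1≤k) ⟩
    suc k C 2            ≤⟨ ℕ.m≤n*m _ 81 ⟩
    81 * (suc k C 2)     ≡⟨ ℕ.*-identityʳ _ ⟨
    81 * (suc k C 2) * 1 ∎

[29+2w]²≤225k : ∀ {k w} → 84 ≤ k → w * w ≤ 35 * k → (29 + 2 * w) * (29 + 2 * w) ≤ 225 * k
[29+2w]²≤225k {k} {w} 84≤k ww≤35k = begin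
  (29 + 2 * w) * (29 + 2 * w)   ≡⟨ solve (w ∷ []) ⟩
  841 + 116 * w + 4 * (w * w)   ≤⟨ ℕ.+-mono-≤ linear-part (ℕ.*-monoʳ-≤ 4 ww≤35k) ⟩
  85 * k + 4 * (35 * k)         ≡⟨ solve (k ∷ []) ⟩
  225 * k                       ∎
  where
  open ℕ.≤-Reasoning
  linear-part : 841 + 116 * w ≤ 85 * k
  linear-part = linear-bound-from-square {w = w} 116 85 841 6299 35 84 refl (ℕ.≤ᵇ⇒≤ _ _ _) (ℕ.≤ᵇ⇒≤ _ _ _)
    84≤k ww≤35k

large-certificate : ∀ {k j} → 84 ≤ k → 1 ≤ j → j ≤ k → Certificate (suc k C 2 + j) (suc k + ν j)
large-certificate {k} {j} 84≤k 1≤j j≤k =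
  certificate 1 (2 * k + 1) (2 * ν j + 1) A-bound B-bound (ℕ.≤-reflexive (rearrange k (ν j)))
  where
  open ℕ.≤-Reasoning
  rearrange : ∀ k v → 2 * (suc k + v) ≡ 2 * k + 1 + (2 * v + 1)
  rearrange = solve-∀
  regroup : ∀ c j → 4 * (2 * c) + 8 * j ≡ 2 * (c + j) * (2 * 2)
  regroup = solve-∀
  A-bound : (2 * k + 1) * (2 * k + 1) ≤ 2 * (suc k C 2 + j) * (2 * 2)
  A-bound = begin
    (2 * k + 1) * (2 * k + 1)     ≡⟨ solve (k ∷ []) ⟩
    4 * (suc k * k) + 1           ≤⟨ ℕ.+-monoʳ-≤ _ (ℕ.≤-trans 1≤j (ℕ.m≤n*m j 8)) ⟩
    4 * (suc k * k) + 8 * j       ≡⟨ cong (λ x → 4 * x + 8 * j) (2*[1+n]C2≡[1+n]*n k) ⟨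
    4 * (2 * (suc k C 2)) + 8 * j ≡⟨ regroup (suc k C 2) j ⟩
    2 * (suc k C 2 + j) * (2 * 2) ∎
  w = 3 * ν j ∸ 13
  B = 2 * ν j + 1
  3B≤29+2w : 3 * B ≤ 29 + 2 * w
  3B≤29+2w = begin
    3 * (2 * ν j + 1)    ≡⟨ distrib (ν j) ⟩
    2 * (3 * ν j) + 3    ≤⟨ ℕ.+-monoˡ-≤ 3 (ℕ.*-monoʳ-≤ 2 (ℕ.m≤n+m∸n (3 * ν j) 13)) ⟩
    2 * (13 + w) + 3     ≡⟨ collect w ⟩
    29 + 2 * w           ∎
    where
    distrib : ∀ v → 3 * (2 * v + 1) ≡ 2 * (3 * v) + 3
    distrib = solve-∀
    collect : ∀ w → 2 * (13 + w) + 3 ≡ 29 + 2 * w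
    collect = solve-∀
  [3B]²≤225k : 3 * B * (3 * B) ≤ 225 * k
  [3B]²≤225k = ℕ.≤-trans (ℕ.*-mono-≤ 3B≤29+2w 3B≤29+2w) ([29+2w]²≤225k {w = w} 84≤k
    (ℕ.≤-trans (crude-ν-bound j) (ℕ.*-monoʳ-≤ 35 j≤k)))
  B-bound : B * B * (B * B) ≤ 81 * (suc k C 2 + j) * (2 * 2 * (2 * 2))
  B-bound = ℕ.*-cancelˡ-≤ 81 (begin
    81 * (B * B * (B * B))                         ≡⟨ fourth-power B ⟩
    3 * B * (3 * B) * (3 * B * (3 * B))            ≤⟨ ℕ.*-mono-≤ [3B]²≤225k [3B]²≤225k ⟩
    225 * k * (225 * k)                            ≡⟨ solve (k ∷ []) ⟩
    225 * 225 * (k * k)                            ≤⟨ ℕ.*-mono-≤ (ℕ.≤ᵇ⇒≤ (225 * 225) (81 * 81 * 8) _)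
                                                                 (ℕ.*-monoˡ-≤ k (ℕ.n≤1+n k)) ⟩
    81 * 81 * 8 * (suc k * k)                      ≡⟨ cong (81 * 81 * 8 *_) (2*[1+n]C2≡[1+n]*n k) ⟨
    81 * 81 * 8 * (2 * (suc k C 2))                ≤⟨ ℕ.*-monoʳ-≤ (81 * 81 * 8) (ℕ.*-monoʳ-≤ 2 (ℕ.m≤m+n (suc k C 2) j)) ⟩
    81 * 81 * 8 * (2 * (suc k C 2 + j))            ≡⟨ regroup-81 (suc k C 2 + j) ⟩
    81 * (81 * (suc k C 2 + j) * (2 * 2 * (2 * 2))) ∎)
    where
    fourth-power : ∀ b → 81 * (b * b * (b * b)) ≡ 3 * b * (3 * b) * (3 * b * (3 * b))
    fourth-power = solve-∀
    regroup-81 : ∀ m → 81 * 81 * 8 * (2 * m) ≡ 81 * (81 * m * (2 * 2 * (2 * 2)))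
    regroup-81 = solve-∀

largestRoot : ℕ → ℕ → ℕ
largestRoot N zero    = zero
largestRoot N (suc b) = if suc b * suc b ≤ᵇ N then suc b else largestRoot N b

-- For a given A the best choice of B is (d + 1) v ∸ A.
certifies : ℕ → ℕ → ℕ → ℕ → Bool
certifies m v d A = (A * A ≤ᵇ 2 * m * (suc d * suc d))
  ∧ (B * B * (B * B) ≤ᵇ 81 * m * (suc d * suc d * (suc d * suc d)))
  ∧ (suc d * v ≤ᵇ A + B)
  where B = suc d * v ∸ A

certifies-sound : ∀ m v d A → T (certifies m v d A) → Certificate m v
certifies-sound m v d A ok = let A-ok , B-ok , split-ok = checks in
  certificate d A B (ℕ.≤ᵇ⇒≤ _ _ A-ok) (ℕ.≤ᵇ⇒≤ _ _ B-ok) (ℕ.≤ᵇ⇒≤ _ _ split-ok)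
  where
  B = suc d * v ∸ A
  checks : T (A * A ≤ᵇ 2 * m * (suc d * suc d))
         × T (B * B * (B * B) ≤ᵇ 81 * m * (suc d * suc d * (suc d * suc d)))
         × T (suc d * v ≤ᵇ A + B)
  checks = map₂ (Equivalence.to T-∧) (Equivalence.to T-∧ ok)

certifiesAt : ℕ → ℕ → ℕ → Bool
certifiesAt m v d = certifies m v d (largestRoot (2 * m * (suc d * suc d)) (suc d * v))

certifiesAt-sound : ∀ m v d → T (certifiesAt m v d) → Certificate m v
certifiesAt-sound m v d = certifies-sound m v d (largestRoot (2 * m * (suc d * suc d)) (suc d * v))

smallCase : ℕ → ℕ → ℕ → Bool
smallCase j νj n = (n ≤ᵇ j) ∨ (n C 2 + j <ᵇ 405) ∨ any (certifiesAt (n C 2 + j) (n + νj)) (upTo 3)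

-- j is the outer index so that ν j is evaluated only once for each j.
small-case-table : T (all (λ j → all (smallCase j (ν j)) (upTo 85)) (upTo 85))
small-case-table = _

small-certificate : ∀ {n j} → n < 85 → j < n → 405 ≤ n C 2 + j → Certificate (n C 2 + j) (n + ν j)
small-certificate {n} {j} n<85 j<n 405≤m =
  [ (λ n≤j → contradiction (ℕ.≤ᵇ⇒≤ n j n≤j) (ℕ.<⇒≱ j<n))
  , [ (λ m<405 → contradiction (ℕ.<ᵇ⇒< _ 405 m<405) (ℕ.≤⇒≯ 405≤m))
    , uncurry (certifiesAt-sound m v) ∘ satisfied ∘ any⁻ (certifiesAt m v) (upTo 3)
    ]′ ∘ Equivalence.to T-∨
  ]′ (Equivalence.to T-∨ case-holds)
  where
  m = n C 2 + j
  v = n + ν j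
  case-holds : T (smallCase j (ν j) n)
  case-holds = T-all-upTo (smallCase j (ν j))
    (T-all-upTo (λ i → all (smallCase i (ν i)) (upTo 85)) small-case-table (ℕ.<-trans j<n n<85)) n<85

greedy-split-certificate : ∀ n j → j < n → 405 ≤ n C 2 + j → Certificate (n C 2 + j) (n + ν j)
greedy-split-certificate (suc zero)    zero    _   ()
greedy-split-certificate (suc (suc k)) zero    _   _ =
  subst₂ Certificate (sym (ℕ.+-identityʳ _)) (sym (ℕ.+-identityʳ _)) (triangular-certificate (s≤s z≤n))
greedy-split-certificate (suc k)       (suc i) j<n 405≤m with suc k <? 85
... | yes n<85 = small-certificate n<85 j<n 405≤m
... | no  n≮85 = large-certificate (ℕ.≤-pred (ℕ.≮⇒≥ n≮85)) (s≤s z≤n) (ℕ.≤-pred j<n)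

certificate-ν : ∀ m → 405 ≤ m → Certificate m (ν m)
certificate-ν (suc m) 405≤m =
  subst₂ Certificate (greedyK-C2+remainder≡id (suc m)) (sym (ν-step m))
    (greedy-split-certificate (greedyK (suc m)) (remainder (suc m)) (remainder<greedyK (suc m))
      (subst (405 ≤_) (sym (greedyK-C2+remainder≡id (suc m))) 405≤m))

mainTheorem6 : (m : ℕ) → 405 ≤ m → (p q : ℚ) → 0ℚ ≤ℚ p → 0ℚ ≤ℚ q →
    ℕtoℚ (2 * m) ≤ℚ p *ℚ p → ℕtoℚ (81 * m) ≤ℚ q *ℚ q *ℚ q *ℚ q →
    ℕtoℚ (ν m) ≤ℚ p +ℚ q
mainTheorem6 m 405≤m p q 0≤p 0≤q 2m≤pp 81m≤q⁴ =
  certificate-sound (certificate-ν m 405≤m) 0≤p 0≤q 2m≤pp 81m≤q⁴
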